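{- Let $k\ge 2$ and let $\mathcal{T}$ be a generalized $k$-forest whose vertex set (the union of its edges) has $v$ elements. Then there is a tight $k$-tree $\mathcal{T}^+$ on the same vertex set such that $\mathcal{T}\subseteq \mathcal{T}^+$ (as families of $k$-sets).
   Context: Generalized $k$-forests are defined inductively as finite sequences (families) of $k$-sets. Every family consisting of a single $k$-set $E_1$ is a generalized $k$-forest. If $\mathcal{T}=\{E_1,\dots,E_u\}$ is a generalized $k$-forest with vertex set $V=E_1\cup\dots\cup E_u$, and $A_{u+1}:=A\subseteq E_i$ for some $1\le i\le u$, and $B$ is a set with $B\cap V=\emptyset$ and $|A|+|B|=k$, then $\{E_1,\dots,E_u,E_{u+1}\}$ with $E_{u+1}:=A\cup B$ is a generalized $k$-forest; the set $A_{u+1}$ is called the defining set of $E_{u+1}$. A generalized $k$-forest is a generalized $k$-tree if it is connected (equivalently, it can be built with all defining sets $A_2,\dots$ nonempty). A tight $k$-forest is a generalized $k$-forest that can be built so that each defining set is either empty or has exactly $k-1$ elements; a tight $k$-tree is a connected tight $k$-forest, i.e. one built so that every defining set $A_2,A_3,\dots$ has exactly $k-1$ elements. -}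

module Defs where

open import Data.Nat using (ℕ; _+_; _∸_)
open import Data.List using (List; []; _∷_; _++_; length; concat)
open import Data.List.Membership.Propositional using (_∈_; _∉_)
open import Data.List.Relation.Binary.Subset.Propositional using (_⊆_)
open import Data.List.Relation.Unary.Unique.Propositional using (Unique)
open import Data.Product using (Σ; _×_)
open import Data.Unit using (⊤)
open import Relation.Binary.PropositionalEquality using (_≡_)

-- A finite set of vertices is represented by
-- a duplicate-free list (so its length is its cardinality); two such lists
-- represent the same set when they have the same members.
VSet : Set
VSet = List ℕ

-- A family of k-sets (a finite sequence of edges).  We store the sequence
-- newest-first: the head of the list is the last edge E_u added.
Family : Set
Family = List VSet

_≈ₛ_ : VSet → VSet → Set
X ≈ₛ Y = (X ⊆ Y) × (Y ⊆ X)

vertices : Family → VSet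
vertices F = concat F

-- Forests built by the inductive construction of the paper, where the
-- admissible sizes of the defining set A are given by the predicate `ok`.
--   * start: a single k-set E_1;
--   * step: A ⊆ E_i for some earlier edge E_i, B disjoint from the current
--     vertex set V, |A| + |B| = k, new edge E_{u+1} = A ∪ B.
data Built (ok : ℕ → Set) (k : ℕ) : Family → Set where
  start : (E : VSet) → Unique E → length E ≡ k → Built ok k (E ∷ [])
  step  : {F : Family} → Built ok k F →
          (Ei : VSet) → Ei ∈ F →
          (A B E : VSet) →
          Unique A → A ⊆ Ei →
          Unique B → (∀ {x} → x ∈ B → x ∉ vertices F) →
          length A + length B ≡ k →
          ok (length A) →
          Unique E → E ≈ₛ (A ++ B) →
          Built ok k (E ∷ F)

AnySize : ℕ → Set
AnySize _ = ⊤

GenForest : ℕ → Family → Set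
GenForest k = Built AnySize k

TightTree : ℕ → Family → Set
TightTree k = Built (λ a → a ≡ k ∸ 1) k

_⊑_ : Family → Family → Set
F ⊑ G = ∀ {E} → E ∈ F → Σ VSet (λ E' → (E' ∈ G) × (E ≈ₛ E'))

module Submission where

-- Given a
-- tight tree G covering the first edges, the next edge A ∪ B (A inside an old
-- edge E_i, B fresh) is reached from an edge X ⊇ E_i of G by a chain of
-- "pivots": as long as B ≠ ∅, remove from X a vertex c ∉ A and put in a fresh
-- vertex b ∈ B.  The new edge (X ∖ c) ∪ {b} has a defining set X ∖ c of size
-- k - 1, so the tree stays tight, and we continue with A ∪ {b} and B ∖ {b}
-- from the new edge.  When B = ∅ the current edge contains A and has the same
-- size, so it equals A ∪ B.

open import Defs
open import Data.Nat using (ℕ; _≤_)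
open import Data.List.Membership.Propositional using (_∈_)
open import Data.Product using (Σ; _×_)
open import Function.Bundles using (_⇔_)

open import Data.Nat using (suc; _+_; _∸_; _<_; z≤n; s≤s; z<s; _≟_)
open import Data.Nat.Properties
  using (≤-antisym; ≤-reflexive; ≤-trans; <⇒≱; +-comm; +-suc; +-identityʳ; m<m+n; module ≤-Reasoning)
open import Data.List using ([]; _∷_; [_]; _++_; length; filter)
open import Data.List.Properties using (filter-notAll; length-++)
open import Data.List.Relation.Unary.Any using (here; there)
import Data.List.Relation.Unary.Any as Any
open import Data.List.Relation.Unary.All using ([]; lookup; tabulate; all?)
open import Data.List.Relation.Unary.All.Properties using (¬All⇒Any¬)
open import Data.List.Relation.Unary.AllPairs using ([]; _∷_)
open import Data.List.Relation.Unary.Unique.Propositional using (Unique)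
import Data.List.Relation.Unary.Unique.Propositional.Properties as Unique
open import Data.List.Relation.Binary.Subset.Propositional using (_⊆_)
open import Data.List.Relation.Binary.Permutation.Propositional using (_↭_; ↭-sym)
open import Data.List.Relation.Binary.Permutation.Propositional.Properties
  using (∈-resp-↭; shift; ++-comm; ++-identityʳ)
open import Data.List.Membership.Propositional using (_∉_; find)
open import Data.List.Membership.Propositional.Properties
  using (∈-filter⁺; ∈-filter⁻; ∈-++⁺ˡ; ∈-++⁺ʳ; ∈-++⁻; ∈-concat⁺′; ∈-concat⁻′)
open import Data.List.Membership.DecPropositional _≟_ using (_∈?_)
open import Data.Product using (∃; _,_; proj₁; proj₂)
open import Data.Sum using (_⊎_; inj₁; inj₂)
open import Data.Empty using (⊥-elim)
open import Relation.Nullary using (yes; no; ¬?)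
open import Relation.Binary.PropositionalEquality using (_≡_; _≢_; refl; sym; trans; cong)
open import Function.Bundles using (mk⇔; Equivalence)

infixl 6 _∖_
_∖_ : VSet → ℕ → VSet
X ∖ c = filter (λ y → ¬? (y ≟ c)) X

∖-⊆ : ∀ {X c y} → y ∈ X ∖ c → y ∈ X
∖-⊆ {c = c} y∈ = proj₁ (∈-filter⁻ (λ y → ¬? (y ≟ c)) y∈)

∖-∈ : ∀ {X c y} → y ∈ X → y ≢ c → y ∈ X ∖ c
∖-∈ {c = c} = ∈-filter⁺ (λ y → ¬? (y ≟ c))

∖-unique : ∀ {X} c → Unique X → Unique (X ∖ c)
∖-unique c = Unique.filter⁺ (λ y → ¬? (y ≟ c))

∖-shorter : ∀ {X c} → c ∈ X → suc (length (X ∖ c)) ≤ length X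
∖-shorter {X} {c} c∈X =
  filter-notAll (λ y → ¬? (y ≟ c)) X (Any.map (λ c≡y y≢c → y≢c (sym c≡y)) c∈X)

card-mono : ∀ {A Y} → Unique A → A ⊆ Y → length A ≤ length Y
card-mono {[]} _ _ = z≤n
card-mono {a ∷ A} {Y} (a∉A ∷ uA) A⊆Y = begin
  suc (length A)       ≤⟨ s≤s (card-mono uA A⊆Y∖a) ⟩
  suc (length (Y ∖ a)) ≤⟨ ∖-shorter (A⊆Y (here refl)) ⟩
  length Y             ∎
  where
  open ≤-Reasoning
  A⊆Y∖a : A ⊆ Y ∖ a
  A⊆Y∖a y∈A = ∖-∈ (A⊆Y (there y∈A)) (λ y≡a → lookup a∉A y∈A (sym y≡a))

∖-length : ∀ {X c} → Unique X → c ∈ X → suc (length (X ∖ c)) ≡ length X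
∖-length {X} {c} uX c∈X = ≤-antisym (∖-shorter c∈X) (card-mono uX X⊆c∷X∖c)
  where
  X⊆c∷X∖c : X ⊆ c ∷ X ∖ c
  X⊆c∷X∖c {y} y∈X with y ≟ c
  ... | yes refl = here refl
  ... | no y≢c   = there (∖-∈ y∈X y≢c)

⊆-or-outside : (X A : VSet) → X ⊆ A ⊎ ∃ (λ c → c ∈ X × c ∉ A)
⊆-or-outside X A with all? (_∈? A) X
... | yes X⊆A  = inj₁ (lookup X⊆A)
... | no X⊈A   = inj₂ (find (¬All⇒Any¬ (_∈? A) X X⊈A))

outside-of-smaller : ∀ {X A} → Unique X → length A < length X → ∃ (λ c → c ∈ X × c ∉ A)
outside-of-smaller {X} {A} uX |A|<|X| with ⊆-or-outside X A
... | inj₁ X⊆A = ⊥-elim (<⇒≱ |A|<|X| (card-mono uX X⊆A))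
... | inj₂ c   = c

full-subset : ∀ {A X} → Unique A → A ⊆ X → length X ≤ length A → X ⊆ A
full-subset {A} {X} uA A⊆X |X|≤|A| with ⊆-or-outside X A
... | inj₁ X⊆A = X⊆A
... | inj₂ (c , c∈X , c∉A) = ⊥-elim (<⇒≱ (≤-trans (∖-shorter c∈X) |X|≤|A|) (card-mono uA A⊆X∖c))
  where
  A⊆X∖c : A ⊆ X ∖ c
  A⊆X∖c y∈A = ∖-∈ (A⊆X y∈A) (λ { refl → c∉A y∈A })

≈ₛ-sym : ∀ {X Y} → X ≈ₛ Y → Y ≈ₛ X
≈ₛ-sym (X⊆Y , Y⊆X) = Y⊆X , X⊆Y

≈ₛ-trans : ∀ {X Y Z} → X ≈ₛ Y → Y ≈ₛ Z → X ≈ₛ Z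
≈ₛ-trans (X⊆Y , Y⊆X) (Y⊆Z , Z⊆Y) = (λ x → Y⊆Z (X⊆Y x)) , (λ z → Y⊆X (Z⊆Y z))

↭⇒≈ₛ : ∀ {X Y} → X ↭ Y → X ≈ₛ Y
↭⇒≈ₛ σ = ∈-resp-↭ σ , ∈-resp-↭ (↭-sym σ)

≈ₛ-length : ∀ {X Y} → Unique X → Unique Y → X ≈ₛ Y → length X ≡ length Y
≈ₛ-length uX uY (X⊆Y , Y⊆X) = ≤-antisym (card-mono uX X⊆Y) (card-mono uY Y⊆X)

Fresh : VSet → Family → Set
Fresh B F = ∀ {x} → x ∈ B → x ∉ vertices F

vertices-mono : ∀ {G H x} → (∀ {E} → E ∈ G → E ∈ H) → x ∈ vertices G → x ∈ vertices H
vertices-mono {G} G⊆H x∈G with ∈-concat⁻′ G x∈G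
... | E , x∈E , E∈G = ∈-concat⁺′ x∈E (G⊆H E∈G)

edge-is-kset : ∀ {ok k G E} → Built ok k G → E ∈ G → Unique E × length E ≡ k
edge-is-kset (start E uE |E|≡k) (here refl) = uE , |E|≡k
edge-is-kset (step _ Ei Ei∈F A B E uA A⊆Ei uB B-fresh |A|+|B|≡k _ uE E≈A∪B) (here refl) =
  uE , trans (≈ₛ-length uE uA∪B E≈A∪B) (trans (length-++ A) |A|+|B|≡k)
  where
  uA∪B : Unique (A ++ B)
  uA∪B = Unique.++⁺ uA uB (λ { (x∈A , x∈B) → B-fresh x∈B (∈-concat⁺′ (A⊆Ei x∈A) Ei∈F) })
edge-is-kset (step b _ _ _ _ _ _ _ _ _ _ _ _ _) (there E∈F) = edge-is-kset b E∈F

pivot : ∀ {k G X c b} → TightTree k G → X ∈ G → c ∈ X → b ∉ vertices G →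
        TightTree k ((b ∷ X ∖ c) ∷ G)
pivot {k} {X = X} {c} {b} tt X∈G c∈X b∉G =
  step tt X X∈G (X ∖ c) [ b ] (b ∷ X ∖ c)
       (∖-unique c uX) ∖-⊆ ([] ∷ []) (λ { (here refl) → b∉G })
       (trans (+-comm (length (X ∖ c)) 1) |X∖c|+1≡k) (cong (_∸ 1) |X∖c|+1≡k)
       (tabulate (λ { y∈X∖c refl → b∉G (∈-concat⁺′ (∖-⊆ y∈X∖c) X∈G) }) ∷ ∖-unique c uX)
       (↭⇒≈ₛ (↭-sym (++-comm (X ∖ c) [ b ])))
  where
  uX : Unique X
  uX = proj₁ (edge-is-kset tt X∈G)
  |X∖c|+1≡k : suc (length (X ∖ c)) ≡ k
  |X∖c|+1≡k = trans (∖-length uX c∈X) (proj₂ (edge-is-kset tt X∈G))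

record Extension (k : ℕ) (G : Family) (A B : VSet) : Set where
  field
    family   : Family
    tight    : TightTree k family
    keeps    : ∀ {E} → E ∈ G → E ∈ family
    adds     : ∀ {x} → x ∈ B → x ∈ vertices family
    onlyAdds : ∀ {x} → x ∈ vertices family → x ∈ vertices G ⊎ x ∈ B
    edge     : VSet
    edge∈    : edge ∈ family
    edge≈    : edge ≈ₛ (A ++ B)

pivot-extension : ∀ {k G A B X' b} → b ∈ X' → (∀ {x} → x ∈ X' → x ≡ b ⊎ x ∈ vertices G) →
                  Extension k (X' ∷ G) (b ∷ A) B → Extension k G A (b ∷ B)
pivot-extension {G = G} {A} {B} {X'} {b} b∈X' X'-new ext = record
  { family   = family
  ; tight    = tight
  ; keeps    = λ E∈G → keeps (there E∈G)
  ; adds     = λ { (here refl) → vertices-mono keeps (∈-++⁺ˡ b∈X') ; (there x∈B) → adds x∈B }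
  ; onlyAdds = onlyAdds′
  ; edge     = edge
  ; edge∈    = edge∈
  ; edge≈    = ≈ₛ-trans edge≈ (↭⇒≈ₛ (↭-sym (shift b A B)))
  }
  where
  open Extension ext
  onlyAdds′ : ∀ {x} → x ∈ vertices family → x ∈ vertices G ⊎ x ∈ b ∷ B
  onlyAdds′ x∈ with onlyAdds x∈
  ... | inj₂ x∈B = inj₂ (there x∈B)
  ... | inj₁ x∈X'∪G with ∈-++⁻ X' x∈X'∪G
  ...   | inj₂ x∈G = inj₁ x∈G
  ...   | inj₁ x∈X' with X'-new x∈X'
  ...     | inj₁ refl = inj₂ (here refl)
  ...     | inj₂ x∈G  = inj₁ x∈G

edge-outside : ∀ {ok k G X} A → Built ok k G → X ∈ G → length A < k → ∃ (λ c → c ∈ X × c ∉ A)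
edge-outside A forest X∈G |A|<k with edge-is-kset forest X∈G
... | uX , refl = outside-of-smaller {A = A} uX |A|<k

extend : ∀ {k G X A B} → TightTree k G → X ∈ G → Unique A → A ⊆ X →
         Unique B → Fresh B G → length A + length B ≡ k → Extension k G A B
extend {G = G} {X} {A} {[]} tt X∈G uA A⊆X _ _ |A|+0≡k = record
  { family = G ; tight = tt ; keeps = λ E∈G → E∈G ; adds = λ ()
  ; onlyAdds = inj₁ ; edge = X ; edge∈ = X∈G
  ; edge≈ = ≈ₛ-trans (full-subset uA A⊆X |X|≤|A| , A⊆X) (↭⇒≈ₛ (↭-sym (++-identityʳ A)))
  }
  where
  |X|≤|A| : length X ≤ length A
  |X|≤|A| = ≤-reflexive (trans (proj₂ (edge-is-kset tt X∈G))
                               (trans (sym |A|+0≡k) (+-identityʳ (length A))))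
extend {G = G} {X} {A} {b ∷ B} tt X∈G uA A⊆X (b∉B ∷ uB) B-fresh |A|+|b∷B|≡k
  with edge-outside A tt X∈G (≤-trans (m<m+n (length A) z<s) (≤-reflexive |A|+|b∷B|≡k))
... | c , c∈X , c∉A =
  pivot-extension (here refl) X'-new
    (extend (pivot tt X∈G c∈X b∉G) (here refl) ub∷A b∷A⊆X' uB B-fresh′
            (trans (sym (+-suc (length A) (length B))) |A|+|b∷B|≡k))
  where
  b∉G : b ∉ vertices G
  b∉G = B-fresh (here refl)
  X'-new : ∀ {x} → x ∈ b ∷ X ∖ c → x ≡ b ⊎ x ∈ vertices G
  X'-new (here refl) = inj₁ refl
  X'-new (there x∈) = inj₂ (∈-concat⁺′ (∖-⊆ x∈) X∈G)
  ub∷A : Unique (b ∷ A)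
  ub∷A = tabulate (λ { y∈A refl → b∉G (∈-concat⁺′ (A⊆X y∈A) X∈G) }) ∷ uA
  b∷A⊆X' : b ∷ A ⊆ b ∷ X ∖ c
  b∷A⊆X' (here refl) = here refl
  b∷A⊆X' (there y∈A) = there (∖-∈ (A⊆X y∈A) (λ { refl → c∉A y∈A }))
  B-fresh′ : Fresh B ((b ∷ X ∖ c) ∷ G)
  B-fresh′ x∈B x∈ with ∈-++⁻ (b ∷ X ∖ c) x∈
  ... | inj₁ (here refl) = lookup b∉B x∈B refl
  ... | inj₁ (there x∈X∖c) = B-fresh (there x∈B) (∈-concat⁺′ (∖-⊆ x∈X∖c) X∈G)
  ... | inj₂ x∈G = B-fresh (there x∈B) x∈G

TightCover : ℕ → Family → Set
TightCover k T = Σ Family (λ T⁺ → TightTree k T⁺ × (∀ x → (x ∈ vertices T) ⇔ (x ∈ vertices T⁺)) × T ⊑ T⁺)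

tight-cover : ∀ {k} T → GenForest k T → TightCover k T
tight-cover _ (start E uE |E|≡k) =
  E ∷ [] , start E uE |E|≡k , (λ _ → mk⇔ (λ x∈ → x∈) (λ x∈ → x∈)) ,
  λ { (here refl) → E , here refl , ((λ x∈ → x∈) , (λ x∈ → x∈)) }
tight-cover {k} _ (step {F} forest Ei Ei∈F A B E uA A⊆Ei uB B-fresh |A|+|B|≡k _ _ E≈A∪B)
  with tight-cover F forest
... | G , tt , same , F⊑G with F⊑G Ei∈F
... | X , X∈G , (Ei⊆X , _) =
  family , tight , (λ x → mk⇔ to from) , E∷F⊑family
  where
  ext : Extension k G A B
  ext = extend tt X∈G uA (λ x∈A → Ei⊆X (A⊆Ei x∈A)) uB
               (λ x∈B x∈G → B-fresh x∈B (Equivalence.from (same _) x∈G)) |A|+|B|≡k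
  open Extension ext
  old : ∀ {x} → x ∈ vertices F → x ∈ vertices family
  old x∈F = vertices-mono keeps (Equivalence.to (same _) x∈F)
  to : ∀ {x} → x ∈ E ++ vertices F → x ∈ vertices family
  to x∈ with ∈-++⁻ E x∈
  ... | inj₂ x∈F = old x∈F
  ... | inj₁ x∈E with ∈-++⁻ A (proj₁ E≈A∪B x∈E)
  ...   | inj₁ x∈A = old (∈-concat⁺′ (A⊆Ei x∈A) Ei∈F)
  ...   | inj₂ x∈B = adds x∈B
  from : ∀ {x} → x ∈ vertices family → x ∈ E ++ vertices F
  from x∈ with onlyAdds x∈
  ... | inj₁ x∈G = ∈-++⁺ʳ E (Equivalence.from (same _) x∈G)
  ... | inj₂ x∈B = ∈-++⁺ˡ (proj₂ E≈A∪B (∈-++⁺ʳ A x∈B))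
  E∷F⊑family : (E ∷ F) ⊑ family
  E∷F⊑family (here refl) = edge , edge∈ , ≈ₛ-trans E≈A∪B (≈ₛ-sym edge≈)
  E∷F⊑family (there E'∈F) with F⊑G E'∈F
  ... | E'' , E''∈G , E'≈E'' = E'' , keeps E''∈G , E'≈E''

proposition3p1 : (k : ℕ) → 2 ≤ k → (T : Family) → GenForest k T →
    Σ Family (λ T⁺ → TightTree k T⁺ × (∀ x → (x ∈ vertices T) ⇔ (x ∈ vertices T⁺)) × T ⊑ T⁺)
proposition3p1 k _ T forest = tight-cover T forest
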